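{- For all integers $n>1$, $$\Lambda_n\ge \left\lfloor \frac32+\sqrt{n-\frac74}\right\rfloor.$$
   Context: An $n$-th order Latin Square is an $n\times n$ grid filled with the symbols $1,\dots,n$ such that each symbol appears exactly once in each row and each column. A monotone subsequence is a subsequence that is strictly increasing or strictly decreasing. $\Lambda_n$ is defined as the largest integer such that every $n$-th order Latin Square has a row (read left to right) or a column (read top to bottom) containing a monotone subsequence of length $\Lambda_n$. -}

module Defs where

open import Data.Nat using (ℕ; suc; _≤_; _+_; _*_; _∸_; _^_)
open import Data.Fin using (Fin) renaming (_<_ to _<ᶠ_; _>_ to _>ᶠ_)
open import Data.Product using (_×_; ∃)
open import Data.Sum using (_⊎_)
open import Function.Definitions using (Bijective)
open import Relation.Binary.PropositionalEquality using (_≡_)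

Grid : ℕ → Set
Grid n = Fin n → Fin n → Fin n

IsLatinSquare : ∀ {n} → Grid n → Set
IsLatinSquare {n} L =
  (∀ (i : Fin n) → Bijective _≡_ _≡_ (L i)) ×
  (∀ (j : Fin n) → Bijective _≡_ _≡_ (λ i → L i j))

StrictlyIncreasing : ∀ {k n} → (Fin k → Fin n) → Set
StrictlyIncreasing {k} g = ∀ (a b : Fin k) → a <ᶠ b → g a <ᶠ g b

StrictlyDecreasing : ∀ {k n} → (Fin k → Fin n) → Set
StrictlyDecreasing {k} g = ∀ (a b : Fin k) → a <ᶠ b → g a >ᶠ g b

HasMonotoneSubseq : ∀ {n} → ℕ → (Fin n → Fin n) → Set
HasMonotoneSubseq {n} k s =
  ∃ λ (g : Fin k → Fin n) →
    StrictlyIncreasing g ×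
    (StrictlyIncreasing (λ a → s (g a)) ⊎ StrictlyDecreasing (λ a → s (g a)))

RowOrColMonotone : ∀ {n} → ℕ → Grid n → Set
RowOrColMonotone {n} k L =
  (∃ λ (i : Fin n) → HasMonotoneSubseq k (L i)) ⊎
  (∃ λ (j : Fin n) → HasMonotoneSubseq k (λ i → L i j))

LambdaProperty : ℕ → ℕ → Set
LambdaProperty n k = ∀ (L : Grid n) → IsLatinSquare L → RowOrColMonotone k L

IsLambda : ℕ → ℕ → Set
IsLambda n Λ = LambdaProperty n Λ × (∀ (k : ℕ) → LambdaProperty n k → k ≤ Λ)

-- For an integer m ≥ 2:  m ≤ 3/2 + √(n − 7/4)  ⇔  (2m − 3)² ≤ 4n − 7,
-- i.e. (2m ∸ 3)² + 7 ≤ 4n.  Since ⌊3/2 + √(n − 7/4)⌋ ≥ 2 for n ≥ 2,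
-- "⌊3/2 + √(n − 7/4)⌋ ≤ Λ" is equivalent to: every m ≥ 2 with this
-- inequality satisfies m ≤ Λ.
BelowBound : ℕ → ℕ → Set
BelowBound n m = 2 ≤ m × (2 * m ∸ 3) ^ 2 + 7 ≤ 4 * n

{-# OPTIONS --safe #-}
module Submission where

open import Defs
open import Data.Nat
  using (ℕ; zero; suc; _≤_; _<_; _+_; _*_; _∸_; _^_; z≤n; s≤s; z<s; s<s; s<s⁻¹; _<?_)
open import Data.Nat.Properties
  using (+-suc; +-comm; +-monoʳ-≤; +-cancelˡ-<; ≮⇒≥; *-cancelˡ-≤; m+n∸m≡n;
         module ≤-Reasoning)
open import Data.Nat.Solver using (module +-*-Solver)
open import Data.Fin as Fin using (Fin; zero; suc; fromℕ; inject≤) renaming (_<_ to _<ᶠ_)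
import Data.Fin.Properties as Finₚ
open import Data.List using (List; []; _∷_; length; filter; lookup; tabulate)
open import Data.List.Properties using (length-tabulate)
open import Data.List.Relation.Unary.All as All using (All; []; _∷_)
import Data.List.Relation.Unary.All.Properties as Allₚ
open import Data.List.Relation.Unary.Any using (Any; here; any?)
open import Data.List.Relation.Unary.AllPairs as AllPairs using (AllPairs; []; _∷_)
open import Data.List.Relation.Unary.AllPairs.Properties using (tabulate⁺-<)
open import Data.List.Membership.Propositional using (_∈_; find; lose)
open import Data.List.Membership.Propositional.Properties using (∈-filter⁻; ∈-lookup)
open import Data.List.Relation.Binary.Sublist.Propositional using (_⊆_; []; _∷_; _∷ʳ_; ⊆-trans)
open import Data.List.Relation.Binary.Sublist.Propositional.Properties using (All-resp-⊆; filter-⊆)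
open import Data.Product using (Σ; ∃; _×_; _,_; proj₁; proj₂)
open import Data.Sum using (_⊎_; inj₁; inj₂)
open import Data.Bool using (true; false)
open import Function using (_∘_)
open import Function.Definitions using (Injective)
open import Level using (0ℓ; _⊔_)
open import Relation.Binary.Core using (Rel)
open import Relation.Binary.Definitions using (Transitive; Decidable; tri<; tri≈; tri>)
open import Relation.Binary.PropositionalEquality using (_≡_; refl; sym; trans; cong; subst; subst₂)
open import Relation.Nullary using (¬_; does; yes; no; contradiction)
open import Relation.Nullary.Decidable using (_×-dec_)
open import Relation.Unary using (Pred)
import Relation.Unary as U
open import Relation.Unary.Properties using (∁?)

-- Let k + 2 = m.  The first column is a bijection, so some row starts with the largest
-- symbol; its other n − 1 entries are all smaller, so a decreasing subsequence of length
-- k + 1 among them extends through the first entry.  Erdős–Szekeres gives, among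
-- n − 1 > (k + 1)k distinct entries, an increasing subsequence of length k + 2 or a
-- decreasing one of length k + 1; and m ≤ 3/2 + √(n − 7/4) reads (2k + 1)² + 7 ≤ 4n,
-- i.e. (k + 1)k < n − 1.
--
-- Erdős–Szekeres follows from Mirsky's theorem for the order i ↗ j (i < j and
-- s i < s j), under which incomparable indices are exactly the decreasing pairs: peel
-- off the minimal elements, an antichain; if there are at most b of them, the other
-- more than a·b elements contain a chain of length a + 1, which extends downwards by a
-- predecessor of its least element.

module _ {a ℓ} {A : Set a} {R : Rel A ℓ} where

  AllPairs-lookup : ∀ {xs} → AllPairs R xs → ∀ {i j} → i <ᶠ j → R (lookup xs i) (lookup xs j)
  AllPairs-lookup (Rx ∷ _)   {zero}  {suc j} _         = All.lookup Rx (∈-lookup j)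
  AllPairs-lookup (_ ∷ Rxs)  {suc i} {suc j} (s<s i<j) = AllPairs-lookup Rxs i<j

  AllPairs⇒Fin-chain : ∀ {k xs} → AllPairs R xs → k ≤ length xs →
                       Σ (Fin k → A) λ g → ∀ a b → a <ᶠ b → R (g a) (g b)
  AllPairs⇒Fin-chain {xs = xs} Rxs k≤ =
    (λ a → lookup xs (inject≤ a k≤)) , λ a b a<b → AllPairs-lookup Rxs (inject≤-mono a<b)
    where
      inject≤-mono : ∀ {a b} → a <ᶠ b → inject≤ a k≤ <ᶠ inject≤ b k≤
      inject≤-mono {a} {b} = subst₂ _<_ (sym (Finₚ.toℕ-inject≤ a k≤)) (sym (Finₚ.toℕ-inject≤ b k≤))

  AllPairs-resp-⊆ : ∀ {xs ys} → xs ⊆ ys → AllPairs R ys → AllPairs R xs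
  AllPairs-resp-⊆ []         []         = []
  AllPairs-resp-⊆ (_ ∷ʳ τ)   (_ ∷ Rys)  = AllPairs-resp-⊆ τ Rys
  AllPairs-resp-⊆ (refl ∷ τ) (Ry ∷ Rys) = All-resp-⊆ τ Ry ∷ AllPairs-resp-⊆ τ Rys

  All⇒AllPairs : ∀ {p} {P : Pred A p} → (∀ {x y} → P x → P y → R x y) →
                 ∀ {xs} → All P xs → AllPairs R xs
  All⇒AllPairs R[P] []         = []
  All⇒AllPairs R[P] (px ∷ pxs) = All.map (R[P] px) pxs ∷ All⇒AllPairs R[P] pxs

module _ {a p} {A : Set a} {P : Pred A p} (P? : U.Decidable P) where

  length-filter+length-filter-∁ : ∀ xs →
    length (filter P? xs) + length (filter (∁? P?) xs) ≡ length xs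
  length-filter+length-filter-∁ []       = refl
  length-filter+length-filter-∁ (x ∷ xs)
    with ih ← length-filter+length-filter-∁ xs | does (P? x)
  ... | true  = cong suc ih
  ... | false = trans (+-suc _ _) (cong suc ih)

Incomparable : ∀ {a ℓ} {A : Set a} → Rel A ℓ → Rel A ℓ
Incomparable _≺_ x y = ¬ x ≺ y × ¬ y ≺ x

module _ {a ℓ} {A : Set a} {_≺_ : Rel A ℓ}
         (≺-trans : Transitive _≺_) (_≺?_ : Decidable _≺_) where

  HasPredecessorIn : List A → Pred A (a ⊔ ℓ)
  HasPredecessorIn xs y = Any (_≺ y) xs

  hasPredecessorIn? : ∀ xs → U.Decidable (HasPredecessorIn xs)
  hasPredecessorIn? xs y = any? (_≺? y) xs

  minimals nonMinimals : List A → List A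
  minimals    xs = filter (∁? (hasPredecessorIn? xs)) xs
  nonMinimals xs = filter (hasPredecessorIn? xs) xs

  minimals-antichain : ∀ xs → AllPairs (Incomparable _≺_) (minimals xs)
  minimals-antichain xs =
    All⇒AllPairs incomparable (All.tabulate (∈-filter⁻ (∁? (hasPredecessorIn? xs))))
    where
      incomparable : ∀ {x y} → x ∈ xs × ¬ HasPredecessorIn xs x →
                     y ∈ xs × ¬ HasPredecessorIn xs y → Incomparable _≺_ x y
      incomparable (x∈ , x-min) (y∈ , y-min) =
        (λ x≺y → y-min (lose x∈ x≺y)) , (λ y≺x → x-min (lose y∈ y≺x))

  nonMinimals-long : ∀ a b xs → suc a * b < length xs → length (minimals xs) ≤ b →
                     a * b < length (nonMinimals xs)
  nonMinimals-long a b xs len min≤b = +-cancelˡ-< b (a * b) _ (begin-strict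
    b + a * b                                      <⟨ len ⟩
    length xs                                      ≡⟨ length-partition ⟨
    length (nonMinimals xs) + length (minimals xs) ≤⟨ +-monoʳ-≤ _ min≤b ⟩
    length (nonMinimals xs) + b                    ≡⟨ +-comm _ b ⟩
    b + length (nonMinimals xs)                    ∎)
    where
      open ≤-Reasoning
      length-partition : length (nonMinimals xs) + length (minimals xs) ≡ length xs
      length-partition = length-filter+length-filter-∁ (hasPredecessorIn? xs) xs

  ∈-nonMinimals⁻ : ∀ xs {y} → y ∈ nonMinimals xs → y ∈ xs × HasPredecessorIn xs y
  ∈-nonMinimals⁻ xs = ∈-filter⁻ (hasPredecessorIn? xs) {xs = xs}

  extendChain : ∀ {a} xs {ys} → All (_∈ nonMinimals xs) ys → AllPairs _≺_ ys →
                suc a ≤ length ys →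
                ∃ λ ys′ → All (_∈ xs) ys′ × AllPairs _≺_ ys′ × suc (suc a) ≤ length ys′
  extendChain xs {y ∷ ys} y∷ys∈ (y≺ys ∷ ≺ys) len
    with j , j∈xs , j≺y ← find (proj₂ (∈-nonMinimals⁻ xs (All.head y∷ys∈))) =
    j ∷ y ∷ ys ,
    j∈xs ∷ All.map (proj₁ ∘ ∈-nonMinimals⁻ xs) y∷ys∈ ,
    (j≺y ∷ All.map (≺-trans j≺y) y≺ys) ∷ y≺ys ∷ ≺ys ,
    s≤s len

  chain⊎antichain : ∀ a b xs → a * b < length xs →
    (∃ λ ys → All (_∈ xs) ys × AllPairs _≺_ ys × suc a ≤ length ys) ⊎
    (∃ λ zs → zs ⊆ xs × AllPairs (Incomparable _≺_) zs × suc b ≤ length zs)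
  chain⊎antichain zero    b (x ∷ xs) _   = inj₁ (x ∷ [] , here refl ∷ [] , [] ∷ [] , s≤s z≤n)
  chain⊎antichain (suc a) b xs       len with b <? length (minimals xs)
  ... | yes b<min = inj₂ (minimals xs , filter-⊆ _ xs , minimals-antichain xs , b<min)
  ... | no  b≮min
    with chain⊎antichain a b (nonMinimals xs) (nonMinimals-long a b xs len (≮⇒≥ b≮min))
  ...   | inj₁ (ys , ys∈ , ≺ys , len′) = inj₁ (extendChain xs ys∈ ≺ys len′)
  ...   | inj₂ (zs , zs⊆ , ∥zs , len′) = inj₂ (zs , ⊆-trans zs⊆ (filter-⊆ _ xs) , ∥zs , len′)

module _ {m n} (s : Fin n → Fin m) where

  _↗_ _↘_ : Rel (Fin n) 0ℓ
  i ↗ j = i <ᶠ j × s i <ᶠ s j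
  i ↘ j = i <ᶠ j × s j <ᶠ s i

  ↗-trans : Transitive _↗_
  ↗-trans (i<j , si<sj) (j<k , sj<sk) = Finₚ.<-trans i<j j<k , Finₚ.<-trans si<sj sj<sk

  _↗?_ : Decidable _↗_
  i ↗? j = (i Fin.<? j) ×-dec (s i Fin.<? s j)

  incomparable⇒↘ : Injective _≡_ _≡_ s → ∀ {i j} → i <ᶠ j → Incomparable _↗_ i j → i ↘ j
  incomparable⇒↘ inj {i} {j} i<j (i↗̸j , _) with Finₚ.<-cmp (s i) (s j)
  ... | tri< si<sj _ _ = contradiction (i<j , si<sj) i↗̸j
  ... | tri≈ _ si≡sj _ = contradiction (inj si≡sj) (Finₚ.<⇒≢ i<j)
  ... | tri> _ _ sj<si = i<j , sj<si

  erdős-szekeres : Injective _≡_ _≡_ s → ∀ a b {xs} → AllPairs _<ᶠ_ xs →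
                   a * b < length xs →
    (∃ λ ys → All (_∈ xs) ys × AllPairs _↗_ ys × suc a ≤ length ys) ⊎
    (∃ λ zs → zs ⊆ xs × AllPairs _↘_ zs × suc b ≤ length zs)
  erdős-szekeres inj a b {xs} sorted len with chain⊎antichain ↗-trans _↗?_ a b xs len
  ... | inj₁ chain                     = inj₁ chain
  ... | inj₂ (zs , zs⊆xs , ∥zs , len′) = inj₂ (zs , zs⊆xs , ↘zs , len′)
    where
      ↘zs : AllPairs _↘_ zs
      ↘zs = AllPairs.zipWith (λ (i<j , i∥j) → incomparable⇒↘ inj i<j i∥j)
                             (AllPairs-resp-⊆ zs⊆xs sorted , ∥zs)

module _ {n} (s : Fin n → Fin n) where

  ↗-chain⇒monotone : ∀ {k ys} → AllPairs (_↗_ s) ys → k ≤ length ys → HasMonotoneSubseq k s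
  ↗-chain⇒monotone ↗ys k≤ with g , g↗ ← AllPairs⇒Fin-chain ↗ys k≤ =
    g , (λ a b a<b → proj₁ (g↗ a b a<b)) , inj₁ (λ a b a<b → proj₂ (g↗ a b a<b))

  ↘-chain⇒monotone : ∀ {k ys} → AllPairs (_↘_ s) ys → k ≤ length ys → HasMonotoneSubseq k s
  ↘-chain⇒monotone ↘ys k≤ with g , g↘ ← AllPairs⇒Fin-chain ↘ys k≤ =
    g , (λ a b a<b → proj₁ (g↘ a b a<b)) , inj₂ (λ a b a<b → proj₂ (g↘ a b a<b))

maxFirst⇒monotone : ∀ {n} k (s : Fin (suc n) → Fin (suc n)) → Injective _≡_ _≡_ s →
                    s zero ≡ fromℕ n → suc k * k < n → HasMonotoneSubseq (2 + k) s
maxFirst⇒monotone {n} k s inj s₀≡max len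
  with erdős-szekeres s inj (suc k) k (tabulate⁺-< s<s)
                      (subst (suc k * k <_) (sym (length-tabulate suc)) len)
... | inj₁ (_ , _ , ↗ys , len′)        = ↗-chain⇒monotone s ↗ys len′
... | inj₂ (zs , zs⊆tail , ↘zs , len′) =
  ↘-chain⇒monotone s (All-resp-⊆ zs⊆tail (Allₚ.tabulate⁺ zero↘) ∷ ↘zs) (s≤s len′)
  where
    zero↘ : ∀ t → _↘_ s zero (suc t)
    zero↘ t = z<s , subst (s (suc t) <ᶠ_) (sym s₀≡max)
      (Finₚ.≤∧≢⇒< (Finₚ.≤fromℕ _)
                  (λ s₁₊ₜ≡max → Finₚ.0≢1+n (inj (trans s₀≡max (sym s₁₊ₜ≡max)))))

lambdaProperty : ∀ {n} k → suc k * k < n → LambdaProperty (suc n) (2 + k)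
lambdaProperty k len L (rows , columns)
  with i , Li₀≡max ← proj₂ (columns zero) (fromℕ _) =
  inj₁ (i , maxFirst⇒monotone k (L i) (proj₁ (rows i)) (Li₀≡max refl) len)

2[2+k]∸3≡1+2k : ∀ k → 2 * (2 + k) ∸ 3 ≡ 1 + 2 * k
2[2+k]∸3≡1+2k k = trans (cong (_∸ 3) (2[2+k]≡3+[1+2k] k)) (m+n∸m≡n 3 (1 + 2 * k))
  where
    2[2+k]≡3+[1+2k] : ∀ k → 2 * (2 + k) ≡ 3 + (1 + 2 * k)
    2[2+k]≡3+[1+2k] =
      solve 1 (λ k → con 2 :* (con 2 :+ k) := con 3 :+ (con 1 :+ con 2 :* k)) refl
      where open +-*-Solver

[1+2k]²+7≡4[2+[1+k]k] : ∀ k → (1 + 2 * k) ^ 2 + 7 ≡ 4 * (2 + (1 + k) * k)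
[1+2k]²+7≡4[2+[1+k]k] = solve 1
  (λ k → (con 1 :+ con 2 :* k) :^ 2 :+ con 7 := con 4 :* (con 2 :+ (con 1 :+ k) :* k)) refl
  where open +-*-Solver

belowBound⇒[1+k]k<n : ∀ {n} k → BelowBound (suc n) (2 + k) → suc k * k < n
belowBound⇒[1+k]k<n {n} k (_ , bound) = s<s⁻¹ (*-cancelˡ-≤ 4 (begin
  4 * (2 + suc k * k)        ≡⟨ [1+2k]²+7≡4[2+[1+k]k] k ⟨
  (1 + 2 * k) ^ 2 + 7        ≡⟨ cong (λ x → x ^ 2 + 7) (2[2+k]∸3≡1+2k k) ⟨
  (2 * (2 + k) ∸ 3) ^ 2 + 7  ≤⟨ bound ⟩
  4 * suc n                  ∎))
  where open ≤-Reasoning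

corollary13 : ∀ (n : ℕ) → 2 ≤ n → ∀ (Λ : ℕ) → IsLambda n Λ →
                  ∀ (m : ℕ) → BelowBound n m → m ≤ Λ
corollary13 (suc n) _ Λ (_ , maximal) (suc (suc k)) bound =
  maximal (2 + k) (lambdaProperty k (belowBound⇒[1+k]k<n k bound))
corollary13 (suc n) _ Λ _ (suc zero) (s≤s () , _)
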